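{- Let $\mathcal{R}$ be a set of rules that is $\neg$-balanced and has $\neg$-depth $k$. Then for every set of formulas $\Gamma\cup\{\varphi\}$ and every $n>k$, $\Gamma\vdash_{\mathcal{R}}\varphi$ implies $f_n(\Gamma)\vdash_{\mathcal{R}}f_n(\varphi)$.
   Context: Language: binary $\land,\lor$, unary $\neg$, constants $\bot,\top$; $Fm$ is the set of formulas; atomic formulas are variables and constants. A rule is a pair $\frac{\Gamma}{\varphi}$ with $\Gamma$ a finite set of formulas; $\vdash_{\mathcal{R}}$ denotes Hilbert derivability with substitution instances of rules in $\mathcal{R}$. The $\neg$-depth of an occurrence of an atomic formula in $\psi$ is the number of $\neg$-headed subformulas of $\psi$ containing that occurrence (the number of $\neg$-nodes above that leaf in the formula tree); the $\neg$-depth of a formula is the maximum over its atomic occurrences, and that of a set of rules is the maximum over all formulas occurring in its rules. A rule is $\neg$-balanced if all occurrences of each variable in it have the same $\neg$-depth, and a set of rules is $\neg$-balanced if all its rules are. Let $\{q_\varphi:\varphi\in Fm\}$ be a set of fresh variables (distinct from the variables used in $\mathcal{R}$ and in the formulas considered), and for $k<\omega$ define $f_k\colon Fm\to Fm$ by $f_k(\top)=\top$, $f_k(\bot)=\bot$, $f_k(p)=p$ for variables $p$, $f_k(\varphi\land\psi)=f_k(\varphi)\land f_k(\psi)$, $f_k(\varphi\lor\psi)=f_k(\varphi)\lor f_k(\psi)$, $f_k(\neg\varphi)=q_{\neg\varphi}$ if $k=0$ and $f_k(\neg\varphi)=\neg f_{k-1}(\varphi)$ if $k>0$; $f_k(\Gamma)=\{f_k(\gamma):\gamma\in\Gamma\}$.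 -}

module Defs where

open import Data.Nat using (ℕ; zero; suc; _⊔_; _≤_; _<_)
open import Data.Sum using (_⊎_; inj₁; inj₂)
open import Data.Product using (Σ; _×_; _,_; ∃)
open import Data.List using (List)
open import Data.List.Membership.Propositional using (_∈_)
open import Data.List.Relation.Unary.All using (All)
open import Relation.Binary.PropositionalEquality using (_≡_)

data Fm (V : Set) : Set where
  var  : V → Fm V
  ⊤'   : Fm V
  ⊥'   : Fm V
  _∧'_ : Fm V → Fm V → Fm V
  _∨'_ : Fm V → Fm V → Fm V
  ¬'_  : Fm V → Fm V

BFm : Set
BFm = Fm ℕ

-- Extended variables: base variables plus the fresh variables q_ψ (ψ ∈ BFm),
-- q_ψ is  inj₂ ψ.
XVar : Set
XVar = ℕ ⊎ BFm

XFm : Set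
XFm = Fm XVar

q : BFm → XFm
q ψ = var (inj₂ ψ)

subst : {V W : Set} → (V → Fm W) → Fm V → Fm W
subst σ (var p)   = σ p
subst σ ⊤'        = ⊤'
subst σ ⊥'        = ⊥'
subst σ (a ∧' b)  = subst σ a ∧' subst σ b
subst σ (a ∨' b)  = subst σ a ∨' subst σ b
subst σ (¬' a)    = ¬' subst σ a

emb : BFm → XFm
emb = subst (λ p → var (inj₁ p))

record Rule : Set where
  constructor _/_
  field
    prem : List BFm
    concl : BFm
open Rule public

RuleSet : Set₁
RuleSet = Rule → Set

FmSet : Set → Set₁
FmSet V = Fm V → Set

data Derivable {V : Set} (R : RuleSet) (Γ : FmSet V) : Fm V → Set where
  assum : ∀ {φ} → Γ φ → Derivable R Γ φ
  rule  : ∀ (r : Rule) → R r → (σ : ℕ → Fm V) →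
          All (λ δ → Derivable R Γ (subst σ δ)) (prem r) →
          Derivable R Γ (subst σ (concl r))

negDepth : {V : Set} → Fm V → ℕ
negDepth (var p)  = 0
negDepth ⊤'       = 0
negDepth ⊥'       = 0
negDepth (a ∧' b) = negDepth a ⊔ negDepth b
negDepth (a ∨' b) = negDepth a ⊔ negDepth b
negDepth (¬' a)   = suc (negDepth a)

InRule : BFm → Rule → Set
InRule φ r = (φ ∈ prem r) ⊎ (φ ≡ concl r)

DepthBound : RuleSet → ℕ → Set
DepthBound R m = ∀ r → R r → ∀ φ → InRule φ r → negDepth φ ≤ m

HasNegDepth : RuleSet → ℕ → Set
HasNegDepth R k = DepthBound R k × (∀ m → DepthBound R m → k ≤ m)

data OccAt {V : Set} (p : V) : Fm V → ℕ → Set where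
  here : OccAt p (var p) 0
  ∧ˡ : ∀ {a b d} → OccAt p a d → OccAt p (a ∧' b) d
  ∧ʳ : ∀ {a b d} → OccAt p b d → OccAt p (a ∧' b) d
  ∨ˡ : ∀ {a b d} → OccAt p a d → OccAt p (a ∨' b) d
  ∨ʳ : ∀ {a b d} → OccAt p b d → OccAt p (a ∨' b) d
  ¬↓ : ∀ {a d} → OccAt p a d → OccAt p (¬' a) (suc d)

BalancedRule : Rule → Set
BalancedRule r = ∀ (p : ℕ) φ ψ d e → InRule φ r → InRule ψ r →
                 OccAt p φ d → OccAt p ψ e → d ≡ e

Balanced : RuleSet → Set
Balanced R = ∀ r → R r → BalancedRule r

f : ℕ → BFm → XFm
f k (var p)       = var (inj₁ p)
f k ⊤'            = ⊤'
f k ⊥'            = ⊥'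
f k (a ∧' b)      = f k a ∧' f k b
f k (a ∨' b)      = f k a ∨' f k b
f zero (¬' a)     = q (¬' a)
f (suc k) (¬' a)  = ¬' f k a

fSet : ℕ → FmSet ℕ → FmSet XVar
fSet k Γ χ = ∃ λ γ → Γ γ × f k γ ≡ χ

-- A rule instance with substitution σ is translated into an instance of the
-- same rule with substitution τ, where τ p := f_{n-d}(σ p) and d is the ¬-depth
-- at which p occurs in the rule.  Balance makes d well defined, and since every
-- formula δ of the rule has ¬-depth ≤ n, the translation f_n commutes with the
-- instantiation: f_n(σ δ) = τ δ.
module Submission where

open import Defs
open import Data.Nat using (ℕ; suc; _<_; _≤_; _∸_; s≤s)
open import Data.Nat.Properties using (_≟_; ≤-trans; <⇒≤; m≤m⊔n; m≤n⊔m)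
open import Data.Sum using (_⊎_; inj₁; inj₂; [_,_])
open import Data.Product using (∃; _,_; map₂)
open import Data.List using (List; []; _∷_)
open import Data.List.Membership.Propositional using (_∈_; find; lose)
open import Data.List.Relation.Unary.Any using (here; there; any?)
open import Data.List.Relation.Unary.All using (All; []; _∷_)
open import Data.Empty using (⊥-elim)
open import Relation.Nullary using (Dec; yes; no)
open import Relation.Nullary.Decidable using (map′; _⊎-dec_)
open import Relation.Binary.PropositionalEquality using (_≡_; refl; sym; cong; cong₂)
  renaming (subst to transport)

Occurs : {V : Set} → V → Fm V → Set
Occurs p δ = ∃ (OccAt p δ)

occurs? : (p : ℕ) (δ : BFm) → Dec (Occurs p δ)
occurs? p (var x) with p ≟ x
... | yes refl = yes (0 , here)
... | no p≢x   = no λ { (_ , here) → p≢x refl }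
occurs? p ⊤'       = no λ ()
occurs? p ⊥'       = no λ ()
occurs? p (a ∧' b) = map′ [ map₂ ∧ˡ , map₂ ∧ʳ ] split (occurs? p a ⊎-dec occurs? p b)
  where
  split : Occurs p (a ∧' b) → Occurs p a ⊎ Occurs p b
  split (d , ∧ˡ o) = inj₁ (d , o)
  split (d , ∧ʳ o) = inj₂ (d , o)
occurs? p (a ∨' b) = map′ [ map₂ ∨ˡ , map₂ ∨ʳ ] split (occurs? p a ⊎-dec occurs? p b)
  where
  split : Occurs p (a ∨' b) → Occurs p a ⊎ Occurs p b
  split (d , ∨ˡ o) = inj₁ (d , o)
  split (d , ∨ʳ o) = inj₂ (d , o)
occurs? p (¬' a)   = map′ (λ { (d , o) → suc d , ¬↓ o }) (λ { (_ , ¬↓ o) → _ , o }) (occurs? p a)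

-- Every occurrence depth d is ≤ negDepth δ ≤ m, so m ∸ d never truncates.
f-subst : (σ : ℕ → BFm) (τ : ℕ → XFm) (m : ℕ) (δ : BFm) → negDepth δ ≤ m →
          (∀ {p d} → OccAt p δ d → τ p ≡ f (m ∸ d) (σ p)) →
          f m (subst σ δ) ≡ subst τ δ
f-subst σ τ m (var p) _ agree = sym (agree here)
f-subst σ τ m ⊤' _ _ = refl
f-subst σ τ m ⊥' _ _ = refl
f-subst σ τ m (a ∧' b) a∧b≤m agree =
  cong₂ _∧'_ (f-subst σ τ m a (≤-trans (m≤m⊔n _ _) a∧b≤m) (λ o → agree (∧ˡ o)))
             (f-subst σ τ m b (≤-trans (m≤n⊔m _ _) a∧b≤m) (λ o → agree (∧ʳ o)))
f-subst σ τ m (a ∨' b) a∨b≤m agree =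
  cong₂ _∨'_ (f-subst σ τ m a (≤-trans (m≤m⊔n _ _) a∨b≤m) (λ o → agree (∨ˡ o)))
             (f-subst σ τ m b (≤-trans (m≤n⊔m _ _) a∨b≤m) (λ o → agree (∨ʳ o)))
f-subst σ τ (suc m) (¬' a) (s≤s a≤m) agree =
  cong ¬'_ (f-subst σ τ m a a≤m (λ o → agree (¬↓ o)))

formulas : Rule → List BFm
formulas r = concl r ∷ prem r

InRule⇒∈formulas : ∀ {δ r} → InRule δ r → δ ∈ formulas r
InRule⇒∈formulas (inj₁ δ∈prem) = there δ∈prem
InRule⇒∈formulas (inj₂ δ≡concl) = here δ≡concl

∈formulas⇒InRule : ∀ {δ r} → δ ∈ formulas r → InRule δ r
∈formulas⇒InRule (here δ≡concl) = inj₂ δ≡concl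
∈formulas⇒InRule (there δ∈prem) = inj₁ δ∈prem

-- Variables not occurring in the rule are mapped arbitrarily.
translateSubst : Rule → ℕ → (ℕ → BFm) → ℕ → XFm
translateSubst r n σ p with any? (occurs? p) (formulas r)
... | yes occ = let _ , _ , d , _ = find occ in f (n ∸ d) (σ p)
... | no _    = var (inj₁ p)

translateSubst-occ : ∀ {r δ p d} n σ → BalancedRule r → InRule δ r → OccAt p δ d →
                     translateSubst r n σ p ≡ f (n ∸ d) (σ p)
translateSubst-occ {r} {δ} {p} {d} n σ bal δ∈r o with any? (occurs? p) (formulas r)
... | yes occ = let _ , δ′∈r , d′ , o′ = find occ in
                cong (λ e → f (n ∸ e) (σ p)) (bal p _ δ d′ d (∈formulas⇒InRule δ′∈r) δ∈r o′ o)
... | no ¬occ = ⊥-elim (¬occ (lose (InRule⇒∈formulas δ∈r) (d , o)))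

f-rule-instance : ∀ {r δ} n σ → BalancedRule r → InRule δ r → negDepth δ ≤ n →
                  f n (subst σ δ) ≡ subst (translateSubst r n σ) δ
f-rule-instance n σ bal δ∈r δ≤n = f-subst σ _ n _ δ≤n (translateSubst-occ n σ bal δ∈r)

module _ (R : RuleSet) (n : ℕ) (bal : Balanced R) (bound : DepthBound R n) (Γ : FmSet ℕ) where

  mutual
    f-derivable : ∀ {φ} → Derivable R Γ φ → Derivable R (fSet n Γ) (f n φ)
    f-derivable (assum γ∈Γ) = assum (_ , γ∈Γ , refl)
    f-derivable (rule r r∈R σ premises) =
      transport (Derivable R (fSet n Γ)) (sym (rule-instance (inj₂ refl)))
        (rule r r∈R (translateSubst r n σ)
          (f-derivable-all (λ δ∈prem → rule-instance (inj₁ δ∈prem)) premises))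
      where
      rule-instance : ∀ {δ} → InRule δ r → f n (subst σ δ) ≡ subst (translateSubst r n σ) δ
      rule-instance δ∈r = f-rule-instance n σ (bal r r∈R) δ∈r (bound r r∈R _ δ∈r)

    f-derivable-all : ∀ {σ τ} {δs : List BFm} →
                      (∀ {δ} → δ ∈ δs → f n (subst σ δ) ≡ subst τ δ) →
                      All (λ δ → Derivable R Γ (subst σ δ)) δs →
                      All (λ δ → Derivable R (fSet n Γ) (subst τ δ)) δs
    f-derivable-all eq [] = []
    f-derivable-all eq (d ∷ ds) =
      transport (Derivable R (fSet n Γ)) (eq (here refl)) (f-derivable d)
      ∷ f-derivable-all (λ δ∈δs → eq (there δ∈δs)) ds

lemma3p6 : (R : RuleSet) (k : ℕ) → Balanced R → HasNegDepth R k →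
    (Γ : FmSet ℕ) (φ : BFm) (n : ℕ) → k < n →
    Derivable R Γ φ → Derivable R (fSet n Γ) (f n φ)
lemma3p6 R k bal (k-bound , _) Γ φ n k<n = f-derivable R n bal n-bound Γ
  where
  n-bound : DepthBound R n
  n-bound r r∈R δ δ∈r = ≤-trans (k-bound r r∈R δ δ∈r) (<⇒≤ k<n)
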